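{- Let $G$ be a simple connected graph of order $p$ and diameter $d \geq 2$. Let $H$ be a connected induced subgraph of $G$ and put $L_0 = V(H)$, where $H$ is chosen so that the vertices of $G$ can be ordered as $y_0, y_1, \ldots, y_{p-1}$ with $d(y_i,y_{i+1}) = d(y_i,L_0)+d(y_{i+1},L_0)+\operatorname{diam}(L_0)$ for $0 \leq i \leq p-2$. Denote $k = \operatorname{diam}(L_0)$ and $\delta = \delta(G)$. Then $$\operatorname{rn}(G) = (p-1)(d-k+1)+\delta-2L(G)$$ holds if and only if there exists an ordering $(x_0,x_1,\ldots,x_{p-1})$ of $V(G)$ satisfying: (a) $d(x_0,L_0)+d(x_{p-1},L_0) = 1$ if $|L_0| = 1$, and $d(x_0,L_0)+d(x_{p-1},L_0) = 0$ if $|L_0| \geq 2$; (b) for all $0 \leq i < j \leq p-1$, $$d(x_i,x_j) \geq \sum_{t=i}^{j-1}\bigl(d(x_t,L_0)+d(x_{t+1},L_0)+k-d-1\bigr)+d+1.$$ Moreover, under conditions (a) and (b), the mapping $\varphi$ defined by $\varphi(x_0) = 0$ and $\varphi(x_{i+1}) = \varphi(x_i) + d + 1 - d(x_i,L_0) - d(x_{i+1},L_0) - k$ for $0 \leq i \leq p-2$ is an optimal radio labeling of $G$.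
   Context: All graphs are simple, finite and connected; $d(u,v)$ is the distance in $G$, $\operatorname{diam}(G)$ the diameter. For $S \subseteq V(G)$, $d(u,S) = \min\{d(u,v): v \in S\}$ and $\operatorname{diam}(S) = \max\{d(u,v) : u,v \in S\}$ (distances taken in $G$; $\operatorname{diam}(S)=0$ if $|S|=1$). A radio labeling of $G$ is a map $\varphi: V(G) \to \mathbb{N}\cup\{0\}$ such that $|\varphi(u)-\varphi(v)| \geq \operatorname{diam}(G)+1-d(u,v)$ for all distinct $u,v \in V(G)$; its span is $\max\{|\varphi(u)-\varphi(v)| : u,v \in V(G)\}$; the radio number $\operatorname{rn}(G)$ is the minimum span over all radio labelings, and a radio labeling is optimal if its span equals $\operatorname{rn}(G)$. Layers with respect to $L_0$: $L_i$ is the set of vertices at distance exactly $i$ from $L_0$, for $0 \le i \le h$ where $h = \max\{d(u,L_0): u \in V(G)\}$. The total level is $L(G) = \sum_{i=1}^{h} i\,|L_i|$. Also $\delta(G) = 1$ if $|L_0| = 1$ and $\delta(G) = 0$ if $|L_0| \geq 2$. -}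

module Defs where

open import Data.Bool using (Bool; true; false; _∧_; _∨_; if_then_else_; T)
open import Data.Nat as ℕ using (ℕ; zero; suc; _+_; _*_; _⊔_; _⊓_; _≤_; _<_; ∣_-_∣)
open import Data.Nat.Properties using (_≟_; _≤?_; _<?_)
open import Data.Integer as ℤ using (ℤ; +_; -_)
open import Data.Fin using (Fin; zero; suc; toℕ; inject₁; fromℕ)
import Data.Fin.Properties as FinP
open import Data.Fin.Subset using (Subset; ∣_∣)
open import Data.Vec using (lookup; tail)
open import Data.Fin.Permutation using (Permutation′; _⟨$⟩ʳ_; _⟨$⟩ˡ_)
open import Data.Product using (Σ; ∃; ∃-syntax; _×_; _,_)
open import Relation.Nullary.Decidable using (⌊_⌋)
open import Relation.Binary.PropositionalEquality using (_≡_; _≢_)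

record Graph (n : ℕ) : Set where
  field
    adj     : Fin n → Fin n → Bool
    irrefl  : ∀ u → adj u u ≡ false
    sym     : ∀ u v → adj u v ≡ adj v u
open Graph public

anyF : ∀ {n} → (Fin n → Bool) → Bool
anyF {zero}  f = false
anyF {suc n} f = f zero ∨ anyF (λ i → f (suc i))

maxF : ∀ {n} → (Fin n → ℕ) → ℕ
maxF {zero}  f = 0
maxF {suc n} f = f zero ⊔ maxF (λ i → f (suc i))

sumF : ∀ {n} → (Fin n → ℕ) → ℕ
sumF {zero}  f = 0
sumF {suc n} f = f zero + sumF (λ i → f (suc i))

sumFℤ : ∀ {n} → (Fin n → ℤ) → ℤ
sumFℤ {zero}  f = + 0
sumFℤ {suc n} f = f zero ℤ.+ sumFℤ (λ i → f (suc i))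

-- minimum of f over a subset S (0 if S is empty; never used that way)
minOver : ∀ {n} → Subset n → (Fin n → ℕ) → ℕ
minOver {zero}  S f = 0
minOver {suc n} S f =
  if lookup S zero
  then (if anyF (lookup (tail S)) then f zero ⊓ minOver (tail S) (λ i → f (suc i)) else f zero)
  else minOver (tail S) (λ i → f (suc i))

-- reachW A G k u v : there is a u–v walk of length ≤ k all of whose
-- vertices after u lie in the allowed set A (u itself is the start)
reachW : ∀ {n} → (Fin n → Bool) → Graph n → ℕ → Fin n → Fin n → Bool
reachW A G zero    u v = ⌊ u FinP.≟ v ⌋
reachW A G (suc k) u v =
  reachW A G k u v ∨ anyF (λ w → reachW A G k u w ∧ adj G w v ∧ A v)

reach : ∀ {n} → Graph n → ℕ → Fin n → Fin n → Bool
reach = reachW (λ _ → true)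

Connected : ∀ {n} → Graph n → Set
Connected G = ∀ u v → ∃[ k ] T (reach G k u v)

InducedConnected : ∀ {n} → Graph n → Subset n → Set
InducedConnected G S =
  (∃[ u ] T (lookup S u)) ×
  (∀ u v → T (lookup S u) → T (lookup S v) → ∃[ k ] T (reachW (lookup S) G k u v))

firstReach : ∀ {n} → Graph n → ℕ → ℕ → Fin n → Fin n → ℕ
firstReach G zero     k u v = k
firstReach G (suc fl) k u v = if reach G k u v then k else firstReach G fl (suc k) u v

-- distance d(u,v): length of a shortest u–v walk (for connected G on n
-- vertices it is < n, so searching k = 0 … n-1 suffices)
dist : ∀ {n} → Graph n → Fin n → Fin n → ℕ
dist {n} G u v = firstReach G n 0 u v

diam : ∀ {n} → Graph n → ℕ
diam G = maxF (λ u → maxF (λ v → dist G u v))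

distSet : ∀ {n} → Graph n → Subset n → Fin n → ℕ
distSet G S u = minOver S (λ v → dist G u v)

-- diam(S), distances taken in G
diamSet : ∀ {n} → Graph n → Subset n → ℕ
diamSet G S = maxF (λ u → maxF (λ v →
  if lookup S u ∧ lookup S v then dist G u v else 0))

height : ∀ {n} → Graph n → Subset n → ℕ
height G S = maxF (distSet G S)

layerSize : ∀ {n} → Graph n → Subset n → ℕ → ℕ
layerSize G S i = sumF (λ v → if ⌊ distSet G S v ≟ i ⌋ then 1 else 0)

sum1to : ℕ → (ℕ → ℕ) → ℕ
sum1to zero    g = 0
sum1to (suc h) g = sum1to h g + g (suc h)

totalLevel : ∀ {n} → Graph n → Subset n → ℕ
totalLevel G S = sum1to (height G S) (λ i → i * layerSize G S i)

deltaG : ∀ {n} → Subset n → ℕ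
deltaG S = if ⌊ ∣ S ∣ ≟ 1 ⌋ then 1 else 0

IsRadioLabeling : ∀ {n} → Graph n → (Fin n → ℕ) → Set
IsRadioLabeling G f =
  ∀ u v → u ≢ v → diam G + 1 ≤ ∣ f u - f v ∣ + dist G u v

span : ∀ {n} → (Fin n → ℕ) → ℕ
span f = maxF (λ u → maxF (λ v → ∣ f u - f v ∣))

IsOptimalRadioLabeling : ∀ {n} → Graph n → (Fin n → ℕ) → Set
IsOptimalRadioLabeling G f =
  IsRadioLabeling G f × (∀ g → IsRadioLabeling G g → span f ≤ span g)

IsRadioNumber : ∀ {n} → Graph n → ℕ → Set
IsRadioNumber G r =
  (∃[ f ] (IsRadioLabeling G f × span f ≡ r)) ×
  (∀ g → IsRadioLabeling G g → r ≤ span g)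

RadioNumberIs : ∀ {n} → Graph n → ℤ → Set
RadioNumberIs G z = ∃[ r ] (IsRadioNumber G r × + r ≡ z)

-- Orderings of V(G) = Fin (suc m):  x_i = π ⟨$⟩ʳ i

Ordering : ℕ → Set
Ordering m = Permutation′ (suc m)

sumBetween : ∀ {m} → ℕ → ℕ → (Fin m → ℤ) → ℤ
sumBetween i j f = sumFℤ (λ t → if ⌊ i ≤? toℕ t ⌋ ∧ ⌊ toℕ t <? j ⌋ then f t else + 0)

seqFromInc : ∀ {m} → (Fin m → ℤ) → Fin (suc m) → ℤ
seqFromInc         inc zero    = + 0
seqFromInc {suc m} inc (suc i) = seqFromInc (λ t → inc (inject₁ t)) i ℤ.+ inc i

module _ {m : ℕ} (G : Graph (suc m)) (L₀ : Subset (suc m)) (x : Ordering m) where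
  private
    X : Fin (suc m) → Fin (suc m)
    X i = x ⟨$⟩ʳ i
    ℓ : Fin (suc m) → ℤ
    ℓ v = + distSet G L₀ v
    d k : ℤ
    d = + diam G
    k = + diamSet G L₀

  CondA : Set
  CondA = (∣ L₀ ∣ ≡ 1 → distSet G L₀ (X zero) + distSet G L₀ (X (fromℕ m)) ≡ 1)
        × (2 ≤ ∣ L₀ ∣ → distSet G L₀ (X zero) + distSet G L₀ (X (fromℕ m)) ≡ 0)

  CondB : Set
  CondB = ∀ (i j : Fin (suc m)) → toℕ i < toℕ j →
    sumBetween (toℕ i) (toℕ j)
       (λ t → ℓ (X (inject₁ t)) ℤ.+ ℓ (X (suc t)) ℤ.+ k ℤ.- d ℤ.- + 1)
      ℤ.+ d ℤ.+ + 1
    ℤ.≤ + dist G (X i) (X j)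

  φpos : Fin (suc m) → ℤ
  φpos = seqFromInc (λ i → d ℤ.+ + 1 ℤ.- ℓ (X (inject₁ i)) ℤ.- ℓ (X (suc i)) ℤ.- k)

  φ : Fin (suc m) → ℤ
  φ v = φpos (x ⟨$⟩ˡ v)

module Submission where

-- Write ℓ(v) = d(v, L₀), k = diam(L₀) and d = diam(G). Passing through nearest points of L₀
-- gives d(u,v) ≤ ℓ(u) + k + ℓ(v). List the vertices as x₀, …, x_{p−1} in increasing order of a
-- radio labeling f; the radio condition on consecutive vertices then forces
-- f(x_{t+1}) − f(x_t) ≥ c_t := d + 1 − ℓ(x_t) − ℓ(x_{t+1}) − k, and summing,
--   span f ≥ Σ c_t = (p − 1)(d − k + 1) − 2L(G) + ℓ(x₀) + ℓ(x_{p−1}) ≥ (p − 1)(d − k + 1) − 2L(G) + δ,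
-- because two distinct vertices cannot both lie in a one-vertex L₀. If span f attains this bound,
-- every inequality is tight: ℓ(x₀) + ℓ(x_{p−1}) = δ, which is (a), and each increment equals c_t,
-- so f(x_j) − f(x_i) = Σ_{i≤t<j} c_t and the radio condition for x_i, x_j becomes (b). Conversely,
-- (b) says precisely that the labeling φ with increments c_t is a radio labeling, and by (a) its
-- span Σ c_t equals the bound.

open import Defs hiding (sym)
open import Data.Bool using (T)
open import Data.Fin.Subset using (Subset)
open import Data.Vec using (lookup)
import Data.Nat as ℕ

module Folds where
  open import Data.Bool using (Bool; true; false; T)
  open import Data.Bool.Properties using (T-∨)
  open import Data.Nat using (ℕ; zero; suc; _+_; _*_; _≤_; z≤n; ∣_-_∣)
  open import Data.Nat.Properties
  open import Data.Fin using (Fin; zero; suc)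
  open import Data.Fin.Permutation using (Permutation′; _⟨$⟩ʳ_)
  open import Data.Fin.Subset using (Subset)
  open import Data.Vec using (_∷_; lookup)
  open import Data.Product using (∃-syntax; _×_; _,_)
  open import Data.Sum using (inj₁; inj₂)
  open import Function.Bundles using (Equivalence)
  open import Relation.Binary.PropositionalEquality using (_≡_; refl; sym; trans; subst; cong; cong₂)
  open import Algebra.Properties.Semiring.Sum +-*-semiring
    using (sum; sum-cong-≗; sum-replicate-zero; sum-permute; *-distribˡ-sum; ∑-distrib-+)
  open Equivalence using (to; from)

  anyF-intro : ∀ {n} (f : Fin n → Bool) i → T (f i) → T (anyF f)
  anyF-intro f zero    p = from T-∨ (inj₁ p)
  anyF-intro f (suc i) p = from (T-∨ {f zero}) (inj₂ (anyF-intro (λ j → f (suc j)) i p))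

  anyF-elim : ∀ {n} (f : Fin n → Bool) → T (anyF f) → ∃[ i ] T (f i)
  anyF-elim {suc n} f p with to (T-∨ {f zero}) p
  ... | inj₁ q = zero , q
  ... | inj₂ q with anyF-elim (λ j → f (suc j)) q
  ...   | i , r = suc i , r

  ≤-maxF : ∀ {n} (f : Fin n → ℕ) i → f i ≤ maxF f
  ≤-maxF f zero    = m≤m⊔n _ _
  ≤-maxF f (suc i) = ≤-trans (≤-maxF (λ j → f (suc j)) i) (m≤n⊔m _ _)

  maxF-least : ∀ {n} (f : Fin n → ℕ) {c} → (∀ i → f i ≤ c) → maxF f ≤ c
  maxF-least {zero}  f f≤c = z≤n
  maxF-least {suc n} f f≤c = ⊔-lub (f≤c zero) (maxF-least (λ j → f (suc j)) (λ j → f≤c (suc j)))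

  ∣-∣≤span : ∀ {n} (f : Fin n → ℕ) u v → ∣ f u - f v ∣ ≤ span f
  ∣-∣≤span f u v =
    ≤-trans (≤-maxF (λ v → ∣ f u - f v ∣) v) (≤-maxF (λ u → maxF (λ v → ∣ f u - f v ∣)) u)

  span-least : ∀ {n} (f : Fin n → ℕ) {c} → (∀ v → f v ≤ c) → span f ≤ c
  span-least f f≤c = maxF-least _ λ u → maxF-least _ λ v →
    ≤-trans (∣m-n∣≤m⊔n (f u) (f v)) (⊔-lub (f≤c u) (f≤c v))

  minOver-attained : ∀ {n} (S : Subset n) (f : Fin n → ℕ) {a} → T (lookup S a) →
                     ∃[ b ] (T (lookup S b) × minOver S f ≡ f b)
  minOver-attained (true ∷ S) f a∈S with anyF (lookup S) in rest
  ... | false = zero , _ , refl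
  ... | true with anyF-elim (lookup S) (subst T (sym rest) _)
  ...   | a′ , a′∈S with minOver-attained S (λ i → f (suc i)) a′∈S
  ...     | b , b∈S , min≡fb with ⊓-sel (f zero) (minOver S (λ i → f (suc i)))
  ...       | inj₁ min≡f0 = zero , _ , min≡f0
  ...       | inj₂ min≡   = suc b , b∈S , trans min≡ min≡fb
  minOver-attained (false ∷ S) f {suc a} a∈S with minOver-attained S (λ i → f (suc i)) a∈S
  ... | b , b∈S , min≡fb = suc b , b∈S , min≡fb

  sumF≡sum : ∀ {n} (f : Fin n → ℕ) → sumF f ≡ sum f
  sumF≡sum {zero}  f = refl
  sumF≡sum {suc n} f = cong (f zero +_) (sumF≡sum (λ i → f (suc i)))

  sumF-cong : ∀ {n} {f g : Fin n → ℕ} → (∀ v → f v ≡ g v) → sumF f ≡ sumF g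
  sumF-cong {f = f} {g} f≗g = trans (sumF≡sum f) (trans (sum-cong-≗ f≗g) (sym (sumF≡sum g)))

  sumF-distrib-+ : ∀ {n} (f g : Fin n → ℕ) → sumF (λ v → f v + g v) ≡ sumF f + sumF g
  sumF-distrib-+ f g = trans (sumF≡sum (λ v → f v + g v))
    (trans (∑-distrib-+ f g) (sym (cong₂ _+_ (sumF≡sum f) (sumF≡sum g))))

  *-distribˡ-sumF : ∀ {n} c (f : Fin n → ℕ) → c * sumF f ≡ sumF (λ v → c * f v)
  *-distribˡ-sumF c f = trans (cong (c *_) (sumF≡sum f))
    (trans (*-distribˡ-sum c f) (sym (sumF≡sum (λ v → c * f v))))

  sumF-permute : ∀ {n} (f : Fin n → ℕ) (π : Permutation′ n) → sumF f ≡ sumF (λ i → f (π ⟨$⟩ʳ i))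
  sumF-permute f π =
    trans (sumF≡sum f) (trans (sum-permute f π) (sym (sumF≡sum (λ i → f (π ⟨$⟩ʳ i)))))

  sum1to-cong : ∀ h {f g : ℕ → ℕ} → (∀ i → f i ≡ g i) → sum1to h f ≡ sum1to h g
  sum1to-cong zero    f≗g = refl
  sum1to-cong (suc h) f≗g = cong₂ _+_ (sum1to-cong h f≗g) (f≗g (suc h))

  sum1to-sumF-comm : ∀ {n} h (F : ℕ → Fin n → ℕ) →
                     sum1to h (λ i → sumF (F i)) ≡ sumF (λ v → sum1to h (λ i → F i v))
  sum1to-sumF-comm {n} zero F = sym (trans (sumF≡sum {n} (λ _ → 0)) (sum-replicate-zero n))
  sum1to-sumF-comm (suc h) F = trans (cong (_+ sumF (F (suc h))) (sum1to-sumF-comm h F))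
                                     (sym (sumF-distrib-+ _ (F (suc h))))

module Subsets where
  open import Data.Bool using (Bool; T)
  open import Data.Bool.Properties using (T-≡)
  open import Data.Nat using (_≤_; _<_)
  open import Data.Fin using (Fin)
  open import Data.Fin.Subset using (Subset; _∈_; ∣_∣)
  open import Data.Fin.Subset.Properties
    using (p⊆q⇒∣p∣≤∣q∣; p⊂q⇒∣p∣<∣q∣; ∣⁅x⁆∣≡1; x∈⁅y⁆⇒x≡y)
  open import Data.Vec using (lookup; tabulate)
  open import Data.Vec.Properties using ([]=⇒lookup; lookup⇒[]=; lookup∘tabulate)
  open import Data.Product using (_,_)
  open import Function.Bundles using (_⇔_; mk⇔; Equivalence)
  open import Relation.Binary.PropositionalEquality using (_≢_; sym; trans; subst)
  open Equivalence using (to; from)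

  T-lookup⇒∈ : ∀ {n} (p : Subset n) {x} → T (lookup p x) → x ∈ p
  T-lookup⇒∈ p {x} t = lookup⇒[]= x p (to T-≡ t)

  ∈⇔T-tabulate : ∀ {n} (f : Fin n → Bool) {x} → x ∈ tabulate f ⇔ T (f x)
  ∈⇔T-tabulate f {x} = mk⇔
    (λ x∈ → from T-≡ (trans (sym (lookup∘tabulate f x)) ([]=⇒lookup x∈)))
    (λ fx → lookup⇒[]= x _ (trans (lookup∘tabulate f x) (to T-≡ fx)))

  ∈⇒1≤∣p∣ : ∀ {n} {p : Subset n} {x} → x ∈ p → 1 ≤ ∣ p ∣
  ∈⇒1≤∣p∣ {x = x} x∈p = subst (_≤ _) (∣⁅x⁆∣≡1 x)
    (p⊆q⇒∣p∣≤∣q∣ (λ y∈⁅x⁆ → subst (_∈ _) (sym (x∈⁅y⁆⇒x≡y x y∈⁅x⁆)) x∈p))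

  distinct∈⇒2≤∣p∣ : ∀ {n} {p : Subset n} {x y} → x ∈ p → y ∈ p → x ≢ y → 2 ≤ ∣ p ∣
  distinct∈⇒2≤∣p∣ {x = x} {y} x∈p y∈p x≢y = subst (_< _) (∣⁅x⁆∣≡1 x)
    (p⊂q⇒∣p∣<∣q∣ ((λ z∈⁅x⁆ → subst (_∈ _) (sym (x∈⁅y⁆⇒x≡y x z∈⁅x⁆)) x∈p) ,
                  y , y∈p , λ y∈⁅x⁆ → x≢y (sym (x∈⁅y⁆⇒x≡y x y∈⁅x⁆))))

module Walks {n} (G : Graph n) where
  open import Data.Bool using (true; false; T; _∧_)
  open import Data.Bool.Properties using (T-∨; T-∧)
  open import Data.Nat using (ℕ; zero; suc; _+_; _≤_; z≤n; s≤s; s≤s⁻¹)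
  open import Data.Nat.Properties
  open import Data.Fin using (Fin)
  import Data.Fin.Properties as Fin
  open import Data.Fin.Subset using (Subset; _∈_; _⊂_; ∣_∣)
  open import Data.Fin.Subset.Properties using (p⊂q⇒∣p∣<∣q∣; ∣p∣≤n)
  open import Data.Vec using (tabulate)
  open import Data.Product using (∃-syntax; _×_; _,_; proj₁)
  open import Data.Sum using (_⊎_; inj₁; inj₂)
  open import Function.Bundles using (Equivalence; _⇔_; mk⇔)
  open import Relation.Binary.PropositionalEquality using (_≡_; _≢_; refl; sym; trans; subst)
  open import Relation.Nullary using (yes; no; contradiction)
  open import Relation.Nullary.Decidable using (toWitness; fromWitness; T?; _×-dec_; ¬?)
  open Equivalence using (to; from)
  open Folds
  open Subsets

  -- A record, so that k, u and v can be inferred from a proof.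
  record Reach (k : ℕ) (u v : Fin n) : Set where
    constructor reached
    field holds : T (reach G k u v)
  open Reach

  reach-0⇒≡ : ∀ {u v} → Reach 0 u v → u ≡ v
  reach-0⇒≡ (reached p) = toWitness p

  reach-0-refl : ∀ u → Reach 0 u u
  reach-0-refl u = reached (fromWitness refl)

  reach-suc : ∀ {k u v} → Reach k u v → Reach (suc k) u v
  reach-suc (reached p) = reached (from T-∨ (inj₁ p))

  reach-step : ∀ {k u w v} → Reach k u w → T (adj G w v) → Reach (suc k) u v
  reach-step {k} {u} {w} {v} (reached p) w~v =
    reached (from (T-∨ {reach G k u v}) (inj₂ (anyF-intro _ w (from T-∧ (p , from T-∧ (w~v , _))))))

  reach-suc⁻ : ∀ {k u v} → Reach (suc k) u v → Reach k u v ⊎ ∃[ w ] (Reach k u w × T (adj G w v))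
  reach-suc⁻ {k} {u} {v} (reached p) with to (T-∨ {reach G k u v}) p
  ... | inj₁ q = inj₁ (reached q)
  ... | inj₂ q with anyF-elim (λ w → reach G k u w ∧ adj G w v ∧ true) q
  ...   | w , r with to T-∧ r
  ...     | u⇝w , w~v = inj₂ (w , reached u⇝w , proj₁ (to T-∧ w~v))

  reach-mono : ∀ {k k′ u v} → k ≤ k′ → Reach k u v → Reach k′ u v
  reach-mono {k′ = zero}   z≤n p = p
  reach-mono {k′ = suc k′} k≤1+k′ p with m≤n⇒m<n∨m≡n k≤1+k′
  ... | inj₁ k<1+k′ = reach-suc (reach-mono (s≤s⁻¹ k<1+k′) p)
  ... | inj₂ refl   = p

  reach-trans : ∀ {a b u v w} → Reach a u v → Reach b v w → Reach (a + b) u w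
  reach-trans {a} {zero} p q rewrite +-identityʳ a | reach-0⇒≡ q = p
  reach-trans {a} {suc b} p q rewrite +-suc a b with reach-suc⁻ q
  ... | inj₁ q′               = reach-suc (reach-trans p q′)
  ... | inj₂ (z , q′ , z~w)   = reach-step (reach-trans p q′) z~w

  reach-sym : ∀ {k u v} → Reach k u v → Reach k v u
  reach-sym {zero} p rewrite reach-0⇒≡ p = reach-0-refl _
  reach-sym {suc k} {u} {v} p with reach-suc⁻ p
  ... | inj₁ q             = reach-suc (reach-sym q)
  ... | inj₂ (w , q , w~v) =
    reach-trans {1} (reach-step (reach-0-refl v) (subst T (Graph.sym G w v) w~v)) (reach-sym q)

  ball : ℕ → Fin n → Subset n
  ball k u = tabulate (reach G k u)

  ∈-ball⇔ : ∀ {k u v} → v ∈ ball k u ⇔ Reach k u v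
  ∈-ball⇔ {k} {u} = mk⇔ (λ v∈ → reached (to (∈⇔T-tabulate (reach G k u)) v∈))
                        (λ p → from (∈⇔T-tabulate (reach G k u)) (holds p))

  Closed : ℕ → Fin n → Set
  Closed k u = ∀ {v} → Reach (suc k) u v → Reach k u v

  closed-suc : ∀ {k u} → Closed k u → Closed (suc k) u
  closed-suc closed p with reach-suc⁻ p
  ... | inj₁ q             = q
  ... | inj₂ (w , q , w~v) = reach-step (closed q) w~v

  closed-+ : ∀ {k u} → Closed k u → ∀ j {v} → Reach (j + k) u v → Reach k u v
  closed-+ closed zero    p = p
  closed-+ {k} {u} closed (suc j) p = closed-+ closed j (closedʲ j p)
    where
    closedʲ : ∀ j → Closed (j + k) u
    closedʲ zero    = closed
    closedʲ (suc j) = closed-suc (closedʲ j)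

  -- Pigeonhole: until it is closed, the ball around u gains a vertex at every step.
  ball-grows : ∀ u k → (∃[ k′ ] (k′ ≤ k × Closed k′ u)) ⊎ suc k ≤ ∣ ball k u ∣
  ball-grows u zero = inj₂ (∈⇒1≤∣p∣ (from (∈-ball⇔ {0}) (reach-0-refl u)))
  ball-grows u (suc k) with ball-grows u k
  ... | inj₁ (k′ , k′≤k , closed) = inj₁ (k′ , m≤n⇒m≤1+n k′≤k , closed)
  ... | inj₂ size with Fin.any? (λ v → T? (reach G (suc k) u v) ×-dec ¬? (T? (reach G k u v)))
  ...   | yes (v , new , ¬old) = inj₂ (<-≤-trans (s≤s size) (p⊂q⇒∣p∣<∣q∣ ball⊂))
    where
    ball⊂ : ball k u ⊂ ball (suc k) u
    ball⊂ = (λ w∈ → from (∈-ball⇔ {suc k}) (reach-suc (to (∈-ball⇔ {k}) w∈))) ,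
            v , from (∈-ball⇔ {suc k}) (reached new) , λ v∈ → ¬old (holds (to (∈-ball⇔ {k}) v∈))
  ...   | no ¬new = inj₁ (k , n≤1+n k , closed)
    where
    closed : Closed k u
    closed {v} (reached p) with T? (reach G k u v)
    ... | yes q = reached q
    ... | no ¬q = contradiction (v , p , ¬q) ¬new

  reach⇒reach-n : ∀ {K u v} → Reach K u v → Reach n u v
  reach⇒reach-n {K} {u} p with ball-grows u n
  ... | inj₁ (k , k≤n , closed) = reach-mono k≤n (closed-+ closed K (reach-mono (m≤m+n K k) p))
  ... | inj₂ size = contradiction (≤-trans size (∣p∣≤n (ball n u))) 1+n≰n

  firstReach-found : ∀ fl k u v → Reach (firstReach G fl k u v) u v ⊎ firstReach G fl k u v ≡ fl + k
  firstReach-found zero     k u v = inj₂ refl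
  firstReach-found (suc fl) k u v with reach G k u v in found
  ... | true  = inj₁ (reached (subst T (sym found) _))
  ... | false with firstReach-found fl (suc k) u v
  ...   | inj₁ p    = inj₁ p
  ...   | inj₂ fr≡ = inj₂ (trans fr≡ (+-suc fl k))

  firstReach-least : ∀ fl {k K u v} → Reach K u v → k ≤ K → firstReach G fl k u v ≤ K
  firstReach-least zero     p k≤K = k≤K
  firstReach-least (suc fl) {k} {K} {u} {v} p k≤K with reach G k u v in found
  ... | true  = k≤K
  ... | false = firstReach-least fl p (≤∧≢⇒< k≤K k≢K)
    where
    k≢K : k ≢ K
    k≢K refl = subst T found (holds p)

  module Metric (conn : Connected G) where

    reach-dist : ∀ u v → Reach (dist G u v) u v
    reach-dist u v with firstReach-found n 0 u v | conn u v
    ... | inj₁ p   | _       = p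
    ... | inj₂ e   | K , u⇝v rewrite e | +-identityʳ n = reach⇒reach-n {K} (reached u⇝v)

    dist-least : ∀ {K u v} → Reach K u v → dist G u v ≤ K
    dist-least p = firstReach-least n p z≤n

    dist-triangle : ∀ u v w → dist G u w ≤ dist G u v + dist G v w
    dist-triangle u v w = dist-least (reach-trans (reach-dist u v) (reach-dist v w))

    dist-sym : ∀ u v → dist G u v ≡ dist G v u
    dist-sym u v = ≤-antisym (dist-least (reach-sym (reach-dist v u)))
                             (dist-least (reach-sym (reach-dist u v)))

    dist≡0⇒≡ : ∀ {u v} → dist G u v ≡ 0 → u ≡ v
    dist≡0⇒≡ {u} {v} e = reach-0⇒≡ (subst (λ k → Reach k u v) e (reach-dist u v))

module Diameter where
  open import Data.Bool using (Bool; true; false; T; _∧_; if_then_else_)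
  open import Data.Bool.Properties using (T-≡)
  open import Data.Nat using (ℕ; suc; _+_; _≤_; z≤n; s≤s; ∣_-_∣)
  open import Data.Nat.Properties
  open import Data.Fin using (Fin)
  import Data.Fin.Properties as Fin
  open import Data.Fin.Subset using (Subset)
  open import Data.Vec using (lookup)
  open import Function.Bundles using (Equivalence)
  open import Function.Definitions using (Injective)
  open import Relation.Binary.PropositionalEquality using (_≡_; sym; subst; cong; cong₂)
  open import Relation.Nullary using (yes; no; contradiction)
  open Equivalence using (to)
  open Folds

  module _ {n} (G : Graph n) where

    dist≤diam : ∀ u v → dist G u v ≤ diam G
    dist≤diam u v = ≤-trans (≤-maxF (dist G u) v) (≤-maxF (λ u → maxF (dist G u)) u)

    dist≤diamSet : ∀ (S : Subset n) {a b} → T (lookup S a) → T (lookup S b) →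
                   dist G a b ≤ diamSet G S
    dist≤diamSet S {a} {b} a∈S b∈S =
      ≤-trans (≤-reflexive inside) (≤-trans (≤-maxF (entry a) b) (≤-maxF (λ u → maxF (entry u)) a))
      where
      entry : Fin n → Fin n → ℕ
      entry u v = if lookup S u ∧ lookup S v then dist G u v else 0
      inside : dist G a b ≡ entry a b
      inside = cong (λ c → if c then dist G a b else 0) (sym (cong₂ _∧_ (to T-≡ a∈S) (to T-≡ b∈S)))

    diamSet≤diam : ∀ S → diamSet G S ≤ diam G
    diamSet≤diam S = maxF-least _ λ u → maxF-least _ λ v →
      ≤-trans (if≤ (lookup S u ∧ lookup S v)) (dist≤diam u v)
      where
      if≤ : ∀ (c : Bool) {x} → (if c then x else 0) ≤ x
      if≤ true  = ≤-refl
      if≤ false = z≤n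

    radio-injective : ∀ {f} → IsRadioLabeling G f → Injective _≡_ _≡_ f
    radio-injective {f} radio {u} {v} fu≡fv with u Fin.≟ v
    ... | yes u≡v = u≡v
    ... | no u≢v  = contradiction (subst (_≤ diam G) (+-comm (diam G) 1) (begin
      diam G + 1                 ≤⟨ radio u v u≢v ⟩
      ∣ f u - f v ∣ + dist G u v ≡⟨ cong (_+ dist G u v) (m≡n⇒∣m-n∣≡0 fu≡fv) ⟩
      dist G u v                 ≤⟨ dist≤diam u v ⟩
      diam G                     ∎)) 1+n≰n
      where open ≤-Reasoning

  1≤diam⇒1≤m : ∀ {m} (G : Graph (suc m)) → 1 ≤ diam G → 1 ≤ m
  1≤diam⇒1≤m {0}     G ()
  1≤diam⇒1≤m {suc m} G _ = s≤s z≤n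

module Levels where
  open import Data.Bool using (if_then_else_)
  open import Data.Nat using (ℕ; zero; suc; _+_; _*_; _≤_; _<_; z≤n; s≤s⁻¹; _≟_)
  open import Data.Nat.Properties
  open import Data.Fin using (Fin)
  open import Data.Sum using (inj₁; inj₂)
  open import Relation.Binary.PropositionalEquality
    using (_≡_; _≢_; ≢-sym; refl; trans; cong₂; module ≡-Reasoning)
  open import Relation.Nullary using (yes; no; contradiction)
  open import Relation.Nullary.Decidable using (⌊_⌋)
  open Folds

  indicator : ℕ → ℕ → ℕ
  indicator e i = if ⌊ e ≟ i ⌋ then 1 else 0

  *-indicator-≢ : ∀ {e i} → e ≢ i → i * indicator e i ≡ 0
  *-indicator-≢ {e} {i} e≢i with e ≟ i
  ... | yes e≡i = contradiction e≡i e≢i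
  ... | no _    = *-zeroʳ i

  *-indicator-≡ : ∀ i → i * indicator i i ≡ i
  *-indicator-≡ i with i ≟ i
  ... | yes _  = *-identityʳ i
  ... | no i≢i = contradiction refl i≢i

  sum1to-indicator-above : ∀ {h e} → h < e → sum1to h (λ i → i * indicator e i) ≡ 0
  sum1to-indicator-above {zero}  h<e = refl
  sum1to-indicator-above {suc h} h<e =
    cong₂ _+_ (sum1to-indicator-above (<-trans (n<1+n h) h<e)) (*-indicator-≢ (≢-sym (<⇒≢ h<e)))

  sum1to-indicator : ∀ {h e} → e ≤ h → sum1to h (λ i → i * indicator e i) ≡ e
  sum1to-indicator {zero}  z≤n = refl
  sum1to-indicator {suc h} e≤1+h with m≤n⇒m<n∨m≡n e≤1+h
  ... | inj₁ e<1+h = trans (cong₂ _+_ (sum1to-indicator (s≤s⁻¹ e<1+h)) (*-indicator-≢ (<⇒≢ e<1+h)))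
                           (+-identityʳ _)
  ... | inj₂ refl  = cong₂ _+_ (sum1to-indicator-above (n<1+n h)) (*-indicator-≡ (suc h))

  totalLevel≡sumF : ∀ {n} (G : Graph n) S → totalLevel G S ≡ sumF (distSet G S)
  totalLevel≡sumF {n} G S = begin
    sum1to h (λ i → i * sumF (λ v → indicator (ℓ v) i))
      ≡⟨ sum1to-cong h (λ i → *-distribˡ-sumF i (λ v → indicator (ℓ v) i)) ⟩
    sum1to h (λ i → sumF (λ v → i * indicator (ℓ v) i))
      ≡⟨ sum1to-sumF-comm h (λ i v → i * indicator (ℓ v) i) ⟩
    sumF (λ v → sum1to h (λ i → i * indicator (ℓ v) i))
      ≡⟨ sumF-cong (λ v → sum1to-indicator (≤-maxF ℓ v)) ⟩
    sumF ℓ ∎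
    where
    open ≡-Reasoning
    ℓ : Fin n → ℕ
    ℓ = distSet G S
    h : ℕ
    h = height G S

module Sorting where
  open import Data.Bool using (Bool)
  open import Data.Nat using (ℕ; suc; _<_; _<?_)
  open import Data.Nat.Properties using (1+n≰n; <-irrefl; <-trans; <-cmp; <⇒≢; <⇒≯)
  open import Data.Fin using (Fin; toℕ; fromℕ<; punchOut)
  import Data.Fin.Properties as Fin
  open import Data.Fin.Subset using (Subset; _∈_; _∉_; _⊂_; ∣_∣)
  open import Data.Fin.Subset.Properties using (p⊂q⇒∣p∣<∣q∣; ∣⊤∣≡n; ⊆⊤; ∈⊤)
  open import Data.Fin.Permutation using (Permutation′; permutation; _⟨$⟩ʳ_)
  open import Data.Vec using (tabulate)
  open import Data.Product using (∃-syntax; _,_; proj₁; proj₂)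
  open import Function.Bundles using (Equivalence; Inverse; _⇔_; mk⇔)
  open import Function.Definitions using (Injective)
  open import Relation.Binary using (tri<; tri≈; tri>)
  open import Relation.Binary.PropositionalEquality
    using (_≡_; _≢_; refl; sym; trans; cong; subst; subst₂)
  open import Relation.Nullary using (yes; no; contradiction)
  open import Relation.Nullary.Decidable using (⌊_⌋; fromWitness; toWitness)
  open Equivalence using (to; from)
  open Subsets

  injective⇒surjective : ∀ {n} {f : Fin n → Fin n} → Injective _≡_ _≡_ f → ∀ j → ∃[ i ] f i ≡ j
  injective⇒surjective {suc n} {f} f-inj j with Fin.any? (λ i → f i Fin.≟ j)
  ... | yes hit = hit
  ... | no ¬hit = contradiction (Fin.injective⇒≤ missed-injective) 1+n≰n
    where
    avoids : ∀ i → j ≢ f i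
    avoids i j≡fi = ¬hit (i , sym j≡fi)
    missed : Fin (suc n) → Fin n
    missed i = punchOut (avoids i)
    missed-injective : Injective _≡_ _≡_ missed
    missed-injective {x} {y} e = f-inj (Fin.punchOut-injective (avoids x) (avoids y) e)

  module _ {m} (g : Fin (suc m) → ℕ) (g-inj : Injective _≡_ _≡_ g) where

    isBelow : Fin (suc m) → Fin (suc m) → Bool
    isBelow v w = ⌊ g w <? g v ⌋

    below : Fin (suc m) → Subset (suc m)
    below v = tabulate (isBelow v)

    ∈-below⇔ : ∀ {v w} → w ∈ below v ⇔ g w < g v
    ∈-below⇔ {v} = mk⇔ (λ w∈ → toWitness (to (∈⇔T-tabulate (isBelow v)) w∈))
                       (λ gw<gv → from (∈⇔T-tabulate (isBelow v)) (fromWitness gw<gv))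

    ∉-below : ∀ v → v ∉ below v
    ∉-below v v∈ = <-irrefl refl (to ∈-below⇔ v∈)

    ∣below∣<1+m : ∀ v → ∣ below v ∣ < suc m
    ∣below∣<1+m v =
      subst (∣ below v ∣ <_) (∣⊤∣≡n (suc m)) (p⊂q⇒∣p∣<∣q∣ (⊆⊤ , v , ∈⊤ , ∉-below v))

    below-⊂ : ∀ {u v} → g u < g v → below u ⊂ below v
    below-⊂ {u} gu<gv = (λ w∈ → from ∈-below⇔ (<-trans (to ∈-below⇔ w∈) gu<gv)) ,
                        u , from ∈-below⇔ gu<gv , ∉-below u

    rank : Fin (suc m) → Fin (suc m)
    rank v = fromℕ< (∣below∣<1+m v)

    rank-mono : ∀ {u v} → g u < g v → toℕ (rank u) < toℕ (rank v)
    rank-mono {u} {v} gu<gv = subst₂ _<_ (sym (Fin.toℕ-fromℕ< (∣below∣<1+m u)))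
                                         (sym (Fin.toℕ-fromℕ< (∣below∣<1+m v)))
                                         (p⊂q⇒∣p∣<∣q∣ (below-⊂ gu<gv))

    rank-injective : Injective _≡_ _≡_ rank
    rank-injective {u} {v} e with <-cmp (g u) (g v)
    ... | tri< gu<gv _ _ = contradiction (cong toℕ e) (<⇒≢ (rank-mono gu<gv))
    ... | tri≈ _ gu≡gv _ = g-inj gu≡gv
    ... | tri> _ _ gv<gu = contradiction (cong toℕ (sym e)) (<⇒≢ (rank-mono gv<gu))

    sortBy : Permutation′ (suc m)
    sortBy = permutation (λ i → proj₁ (unrank i)) rank
                         (λ v → rank-injective (proj₂ (unrank (rank v)))) (λ i → proj₂ (unrank i))
      where
      unrank : ∀ i → ∃[ v ] rank v ≡ i
      unrank = injective⇒surjective rank-injective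

    rank∘sortBy : ∀ i → rank (sortBy ⟨$⟩ʳ i) ≡ i
    rank∘sortBy = Inverse.strictlyInverseʳ sortBy

    sortBy-increasing : ∀ {i j} → toℕ i < toℕ j → g (sortBy ⟨$⟩ʳ i) < g (sortBy ⟨$⟩ʳ j)
    sortBy-increasing {i} {j} i<j with <-cmp (g (sortBy ⟨$⟩ʳ i)) (g (sortBy ⟨$⟩ʳ j))
    ... | tri< gi<gj _ _ = gi<gj
    ... | tri≈ _ gi≡gj _ = contradiction (cong toℕ i≡j) (<⇒≢ i<j)
      where
      i≡j : i ≡ j
      i≡j = trans (sym (rank∘sortBy i)) (trans (cong rank (g-inj gi≡gj)) (rank∘sortBy j))
    ... | tri> _ _ gj<gi = contradiction
      (subst₂ _<_ (cong toℕ (rank∘sortBy j)) (cong toℕ (rank∘sortBy i)) (rank-mono gj<gi)) (<⇒≯ i<j)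

module PrefixSums where
  open import Data.Bool using (_∧_; if_then_else_)
  import Data.Nat as ℕ
  open ℕ using (ℕ; zero; suc; z≤n; s≤s⁻¹)
  import Data.Nat.Properties as ℕ
  open import Data.Integer using (ℤ; +_; -_; _+_; _-_; _*_; _≤_; +≤+; 0ℤ)
  open import Data.Integer.Properties
  open import Data.Integer.Tactic.RingSolver using (solve-∀)
  open import Data.Fin using (Fin; toℕ; inject₁)
  import Data.Fin.Properties as Fin
  open import Data.Sum using (inj₁; inj₂)
  open import Relation.Binary.PropositionalEquality
    using (_≡_; refl; sym; trans; cong; cong₂; subst; subst₂; module ≡-Reasoning)
  open import Function.Bundles using (_⇔_; mk⇔)
  open import Relation.Nullary using (yes; no; contradiction)
  open import Relation.Nullary.Decidable using (⌊_⌋)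

  ≤-rearrange : ∀ {a b a′ b′} → b - a ≡ b′ - a′ → a ≤ b → a′ ≤ b′
  ≤-rearrange eq a≤b = 0≤i-j⇒j≤i (subst (0ℤ ≤_) eq (i≤j⇒0≤j-i a≤b))

  +-≤-+⇔ : ∀ a b c e → a ℕ.+ b ℕ.≤ c ℕ.+ e ⇔ + a + + b ≤ + c + + e
  +-≤-+⇔ a b c e = mk⇔ (λ ≤ℕ → subst₂ _≤_ (pos-+ a b) (pos-+ c e) (+≤+ ≤ℕ))
                           (λ ≤ℤ → drop‿+≤+ (subst₂ _≤_ (sym (pos-+ a b)) (sym (pos-+ c e)) ≤ℤ))

  +∣m-n∣≡n-m : ∀ {m n} → m ℕ.≤ n → + ℕ.∣ m - n ∣ ≡ + n - + m
  +∣m-n∣≡n-m {m} {n} m≤n =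
    trans (cong +_ (ℕ.m≤n⇒∣m-n∣≡n∸m m≤n)) (trans (sym (⊖-≥ m≤n)) (sym (m-n≡m⊖n n m)))

  n-m≤+∣m-n∣ : ∀ m n → + n - + m ≤ + ℕ.∣ m - n ∣
  n-m≤+∣m-n∣ m n with ℕ.≤-total m n
  ... | inj₁ m≤n = ≤-reflexive (sym (+∣m-n∣≡n-m m≤n))
  ... | inj₂ n≤m = ≤-trans (i≤j⇒i-j≤0 (+≤+ n≤m)) (+≤+ z≤n)

  neg-+≤⇔ : ∀ {s s′ a b} → s ≡ - s′ → (s + a + + 1 ≤ b) ⇔ (a + + 1 ≤ s′ + b)
  neg-+≤⇔ {s′ = s′} {a} {b} refl =
    mk⇔ (≤-rearrange (shuffle s′ a b)) (≤-rearrange (sym (shuffle s′ a b)))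
    where shuffle : ∀ s a b → b - (- s + a + + 1) ≡ (s + b) - (a + + 1)
          shuffle = solve-∀

  sum< : ℕ → (ℕ → ℤ) → ℤ
  sum< zero    F = 0ℤ
  sum< (suc j) F = sum< j F + F j

  sum<-cong : ∀ j {F H : ℕ → ℤ} → (∀ t → t ℕ.< j → F t ≡ H t) → sum< j F ≡ sum< j H
  sum<-cong zero    F≗H = refl
  sum<-cong (suc j) F≗H =
    cong₂ _+_ (sum<-cong j (λ t t<j → F≗H t (ℕ.m<n⇒m<1+n t<j))) (F≗H j ℕ.≤-refl)

  sum<-mono-≤ : ∀ j {F H : ℕ → ℤ} → (∀ t → t ℕ.< j → F t ≤ H t) → sum< j F ≤ sum< j H
  sum<-mono-≤ zero    F≤H = ≤-refl
  sum<-mono-≤ (suc j) F≤H =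
    +-mono-≤ (sum<-mono-≤ j (λ t t<j → F≤H t (ℕ.m<n⇒m<1+n t<j))) (F≤H j ℕ.≤-refl)

  sum<-distrib-+ : ∀ j (F H : ℕ → ℤ) → sum< j (λ t → F t + H t) ≡ sum< j F + sum< j H
  sum<-distrib-+ zero    F H = refl
  sum<-distrib-+ (suc j) F H rewrite sum<-distrib-+ j F H = swap (sum< j F) (sum< j H) (F j) (H j)
    where swap : ∀ a b c d → a + b + (c + d) ≡ a + c + (b + d)
          swap = solve-∀

  sum<-distrib-- : ∀ j (F H : ℕ → ℤ) → sum< j (λ t → F t - H t) ≡ sum< j F - sum< j H
  sum<-distrib-- zero    F H = refl
  sum<-distrib-- (suc j) F H rewrite sum<-distrib-- j F H = swap (sum< j F) (sum< j H) (F j) (H j)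
    where swap : ∀ a b c d → a - b + (c - d) ≡ a + c - (b + d)
          swap = solve-∀

  sum<-neg : ∀ j (F : ℕ → ℤ) → sum< j (λ t → - F t) ≡ - sum< j F
  sum<-neg zero    F = refl
  sum<-neg (suc j) F rewrite sum<-neg j F = sym (neg-distrib-+ (sum< j F) (F j))

  sum<-const : ∀ j c → sum< j (λ _ → c) ≡ + j * c
  sum<-const zero    c = sym (*-zeroˡ c)
  sum<-const (suc j) c rewrite sum<-const j c = step (+ j) c
    where step : ∀ a c → a * c + c ≡ (+ 1 + a) * c
          step = solve-∀

  sum<-shift : ∀ j (F : ℕ → ℤ) → sum< (suc j) F ≡ F 0 + sum< j (λ t → F (suc t))
  sum<-shift zero    F = +-comm 0ℤ (F 0)
  sum<-shift (suc j) F = trans (cong (_+ F (suc j)) (sum<-shift j F)) (+-assoc (F 0) _ _)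

  sum<-telescope : ∀ j (A : ℕ → ℤ) → sum< j (λ t → A (suc t) - A t) ≡ A j - A 0
  sum<-telescope zero    A = sym (+-inverseʳ (A 0))
  sum<-telescope (suc j) A rewrite sum<-telescope j A = step (A j) (A 0) (A (suc j))
    where step : ∀ a b c → a - b + (c - a) ≡ c - b
          step = solve-∀

  sum<-mono-bound : ∀ {M} {F : ℕ → ℤ} → (∀ t → t ℕ.< M → 0ℤ ≤ F t) →
                    ∀ {i j} → i ℕ.≤ j → j ℕ.≤ M → sum< i F ≤ sum< j F
  sum<-mono-bound F≥0 {j = zero} z≤n _ = ≤-refl
  sum<-mono-bound {F = F} F≥0 {i} {suc j} i≤1+j 1+j≤M with ℕ.m≤n⇒m<n∨m≡n i≤1+j
  ... | inj₂ refl  = ≤-refl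
  ... | inj₁ i<1+j = ≤-trans (sum<-mono-bound F≥0 (s≤s⁻¹ i<1+j) (ℕ.<⇒≤ 1+j≤M))
                             (≤-trans (≤-reflexive (sym (+-identityʳ _)))
                                      (+-monoʳ-≤ (sum< j F) (F≥0 j 1+j≤M)))

  sumFℤ-cong : ∀ {m} {f g : Fin m → ℤ} → (∀ t → f t ≡ g t) → sumFℤ f ≡ sumFℤ g
  sumFℤ-cong {zero}  f≗g = refl
  sumFℤ-cong {suc m} f≗g = cong₂ _+_ (f≗g Fin.zero) (sumFℤ-cong (λ t → f≗g (Fin.suc t)))

  sumFℤ-pos : ∀ {m} (f : Fin m → ℕ) → sumFℤ (λ t → + f t) ≡ + sumF f
  sumFℤ-pos {zero}  f = refl
  sumFℤ-pos {suc m} f = trans (cong (λ z → + f Fin.zero + z) (sumFℤ-pos (λ t → f (Fin.suc t))))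
                              (sym (pos-+ (f Fin.zero) _))

  sumFℤ≡sum< : ∀ m (H : ℕ → ℤ) → sumFℤ {m} (λ t → H (toℕ t)) ≡ sum< m H
  sumFℤ≡sum< zero    H = refl
  sumFℤ≡sum< (suc m) H =
    trans (cong (λ z → H 0 + z) (sumFℤ≡sum< m (λ t → H (suc t)))) (sym (sum<-shift m H))

  prefix : ℕ → (ℕ → ℤ) → ℕ → ℤ
  prefix j F t = if ⌊ t ℕ.<? j ⌋ then F t else 0ℤ

  prefix-< : ∀ {j F t} → t ℕ.< j → prefix j F t ≡ F t
  prefix-< {j} {F} {t} t<j with t ℕ.<? j
  ... | yes _   = refl
  ... | no t≮j = contradiction t<j t≮j

  prefix-≥ : ∀ {j F t} → j ℕ.≤ t → prefix j F t ≡ 0ℤ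
  prefix-≥ {j} {F} {t} j≤t with t ℕ.<? j
  ... | yes t<j = contradiction j≤t (ℕ.<⇒≱ t<j)
  ... | no _    = refl

  sum<-prefix : ∀ {j n} (F : ℕ → ℤ) → j ℕ.≤ n → sum< n (prefix j F) ≡ sum< j F
  sum<-prefix {n = zero}  F z≤n = refl
  sum<-prefix {j} {suc n} F j≤1+n with ℕ.m≤n⇒m<n∨m≡n j≤1+n
  ... | inj₁ j<1+n =
    trans (cong₂ _+_ (sum<-prefix F (s≤s⁻¹ j<1+n)) (prefix-≥ {F = F} (s≤s⁻¹ j<1+n))) (+-identityʳ _)
  ... | inj₂ refl  = sum<-cong (suc n) (λ t → prefix-< {F = F})

  window : ℕ → ℕ → (ℕ → ℤ) → ℕ → ℤ
  window i j F t = if ⌊ i ℕ.≤? t ⌋ ∧ ⌊ t ℕ.<? j ⌋ then F t else 0ℤ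

  window≡prefix-prefix : ∀ {i j} F t → i ℕ.≤ j → window i j F t ≡ prefix j F t - prefix i F t
  window≡prefix-prefix {i} {j} F t i≤j with i ℕ.≤? t
  ... | yes i≤t rewrite prefix-≥ {F = F} i≤t = sym (+-identityʳ _)
  ... | no i≰t  rewrite prefix-< {F = F} (ℕ.≰⇒> i≰t)
                      | prefix-< {F = F} (ℕ.<-≤-trans (ℕ.≰⇒> i≰t) i≤j) = sym (+-inverseʳ (F t))

  sum<-window : ∀ {i j n} (F : ℕ → ℤ) → i ℕ.≤ j → j ℕ.≤ n →
                sum< n (window i j F) ≡ sum< j F - sum< i F
  sum<-window {i} {j} {n} F i≤j j≤n = begin
    sum< n (window i j F)
      ≡⟨ sum<-cong n (λ t _ → window≡prefix-prefix F t i≤j) ⟩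
    sum< n (λ t → prefix j F t - prefix i F t)
      ≡⟨ sum<-distrib-- n (prefix j F) (prefix i F) ⟩
    sum< n (prefix j F) - sum< n (prefix i F)
      ≡⟨ cong₂ _-_ (sum<-prefix F j≤n) (sum<-prefix F (ℕ.≤-trans i≤j j≤n)) ⟩
    sum< j F - sum< i F ∎
    where open ≡-Reasoning

  sumBetween≡sum< : ∀ {m} {f : Fin m → ℤ} (F : ℕ → ℤ) → (∀ t → f t ≡ F (toℕ t)) →
                    ∀ {i j} → i ℕ.≤ j → j ℕ.≤ m → sumBetween i j f ≡ sum< j F - sum< i F
  sumBetween≡sum< {m} F f≗F {i} {j} i≤j j≤m = trans
    (sumFℤ-cong (λ t → cong (λ z → if ⌊ i ℕ.≤? toℕ t ⌋ ∧ ⌊ toℕ t ℕ.<? j ⌋ then z else 0ℤ) (f≗F t)))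
    (trans (sumFℤ≡sum< m (window i j F)) (sum<-window F i≤j j≤m))

  seqFromInc≡sum< : ∀ {m} {inc : Fin m → ℤ} (I : ℕ → ℤ) → (∀ t → inc t ≡ I (toℕ t)) →
                    ∀ i → seqFromInc inc i ≡ sum< (toℕ i) I
  seqFromInc≡sum< I inc≗I Fin.zero = refl
  seqFromInc≡sum< {suc m} I inc≗I (Fin.suc i) =
    cong₂ _+_ (seqFromInc≡sum< I (λ t → trans (inc≗I (inject₁ t)) (cong I (Fin.toℕ-inject₁ t))) i)
              (inc≗I i)

  sum<-tight : ∀ {m} {c Δ : ℕ → ℤ} → (∀ t → t ℕ.< m → c t ≤ Δ t) → sum< m Δ ≤ sum< m c →
               ∀ {i j} → i ℕ.≤ j → j ℕ.≤ m → sum< j Δ - sum< i Δ ≤ sum< j c - sum< i c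
  sum<-tight {m} {c} {Δ} c≤Δ total {i} {j} i≤j j≤m =
    ≤-rearrange (regroup (sum< j c) (sum< i c) (sum< j Δ) (sum< i Δ))
                (subst₂ _≤_ (sum<-distrib-- j Δ c) (sum<-distrib-- i Δ c) excess-j≤excess-i)
    where
    excess : ℕ → ℤ
    excess t = Δ t - c t
    excess≥0 : ∀ t → t ℕ.< m → 0ℤ ≤ excess t
    excess≥0 t t<m = i≤j⇒0≤j-i (c≤Δ t t<m)
    total-excess≤0 : sum< m excess ≤ 0ℤ
    total-excess≤0 = subst (_≤ 0ℤ) (sym (sum<-distrib-- m Δ c)) (i≤j⇒i-j≤0 total)
    excess-j≤excess-i : sum< j excess ≤ sum< i excess
    excess-j≤excess-i = ≤-trans (≤-trans (sum<-mono-bound excess≥0 j≤m ℕ.≤-refl) total-excess≤0)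
                                (sum<-mono-bound excess≥0 z≤n (ℕ.≤-trans i≤j j≤m))
    regroup : ∀ jc ic jΔ iΔ → (iΔ - ic) - (jΔ - jc) ≡ (jc - ic) - (jΔ - iΔ)
    regroup = solve-∀

module Layers {n} (G : Graph n) (conn : Connected G)
              (L₀ : Subset n) {w₀} (w₀∈L₀ : T (lookup L₀ w₀)) where
  open import Data.Bool using (T)
  open import Data.Nat using (ℕ; zero; suc; _+_; _≤_; z≤n; s≤s; _≟_)
  open import Data.Nat.Properties
  open import Data.Fin using (Fin)
  open import Data.Fin.Subset using (Subset; ∣_∣)
  open import Data.Vec using (lookup)
  open import Data.Product using (∃-syntax; _×_; _,_)
  open import Function.Bundles using (_⇔_; mk⇔)
  open import Relation.Binary.PropositionalEquality using (_≡_; _≢_; ≢-sym; sym; trans)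
  open import Relation.Nullary using (yes; no; contradiction)
  open Walks.Metric G conn
  open Folds
  open Diameter
  open Subsets

  ℓ : Fin n → ℕ
  ℓ = distSet G L₀

  distSet-attained : ∀ u → ∃[ b ] (T (lookup L₀ b) × ℓ u ≡ dist G u b)
  distSet-attained u = minOver-attained L₀ (dist G u) w₀∈L₀

  distSet≡0⇒∈ : ∀ {u} → ℓ u ≡ 0 → T (lookup L₀ u)
  distSet≡0⇒∈ {u} ℓu≡0 with distSet-attained u
  ... | b , b∈L₀ , ℓu≡d rewrite dist≡0⇒≡ (trans (sym ℓu≡d) ℓu≡0) = b∈L₀

  dist≤via-L₀ : ∀ u v → dist G u v ≤ ℓ u + diamSet G L₀ + ℓ v
  dist≤via-L₀ u v with distSet-attained u | distSet-attained v
  ... | a , a∈L₀ , ℓu≡ | b , b∈L₀ , ℓv≡ rewrite ℓu≡ | ℓv≡ = begin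
    dist G u v                              ≤⟨ dist-triangle u a v ⟩
    dist G u a + dist G a v                 ≤⟨ +-monoʳ-≤ (dist G u a) (dist-triangle a b v) ⟩
    dist G u a + (dist G a b + dist G b v)  ≡⟨ sym (+-assoc (dist G u a) _ _) ⟩
    dist G u a + dist G a b + dist G b v    ≤⟨ +-mono-≤ (+-monoʳ-≤ (dist G u a) (dist≤diamSet G L₀ a∈L₀ b∈L₀))
                                                        (≤-reflexive (dist-sym b v)) ⟩
    dist G u a + diamSet G L₀ + dist G v b  ∎
    where open ≤-Reasoning

  1≤∣L₀∣ : 1 ≤ ∣ L₀ ∣
  1≤∣L₀∣ = ∈⇒1≤∣p∣ (T-lookup⇒∈ L₀ w₀∈L₀)

  -- When L₀ is a single vertex, two distinct vertices cannot both lie at level 0.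
  deltaG≤ℓ+ℓ : ∀ {u v} → u ≢ v → deltaG L₀ ≤ ℓ u + ℓ v
  deltaG≤ℓ+ℓ {u} {v} u≢v with ∣ L₀ ∣ ≟ 1 | ℓ u in ℓu | ℓ v in ℓv
  ... | no _      | _     | _     = z≤n
  ... | yes _     | suc _ | _     = s≤s z≤n
  ... | yes _     | zero  | suc _ = s≤s z≤n
  ... | yes ∣L₀∣≡1 | zero  | zero  = contradiction ∣L₀∣≡1 (λ e → <⇒≢ (distinct∈⇒2≤∣p∣
          (T-lookup⇒∈ L₀ (distSet≡0⇒∈ ℓu)) (T-lookup⇒∈ L₀ (distSet≡0⇒∈ ℓv)) u≢v) (sym e))

  deltaG-cases⇔ : ∀ s → ((∣ L₀ ∣ ≡ 1 → s ≡ 1) × (2 ≤ ∣ L₀ ∣ → s ≡ 0)) ⇔ (s ≡ deltaG L₀)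
  deltaG-cases⇔ s with ∣ L₀ ∣ ≟ 1
  ... | yes ∣L₀∣≡1 = mk⇔ (λ (one , _) → one ∣L₀∣≡1)
                         (λ s≡1 → (λ _ → s≡1) ,
                                  λ 2≤∣L₀∣ → contradiction ∣L₀∣≡1 (λ e → <⇒≢ 2≤∣L₀∣ (sym e)))
  ... | no ∣L₀∣≢1  = mk⇔ (λ (_ , none) → none (≤∧≢⇒< 1≤∣L₀∣ (≢-sym ∣L₀∣≢1)))
                         (λ s≡0 → (λ ∣L₀∣≡1 → contradiction ∣L₀∣≡1 ∣L₀∣≢1) , λ _ → s≡0)

module Radio {n} (G : Graph n) (conn : Connected G) where
  open import Data.Nat using (ℕ; _+_; _<_; _≤_; ∣_-_∣)
  open import Data.Fin using (Fin)
  open import Data.Nat.Properties using (∣-∣-comm)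
  open import Data.Fin using (toℕ)
  import Data.Fin.Properties as Fin
  open import Data.Fin.Permutation using (Permutation′; _⟨$⟩ʳ_; _⟨$⟩ˡ_; inverseʳ)
  open import Relation.Binary using (tri<; tri≈; tri>)
  open import Relation.Binary.PropositionalEquality using (sym; trans; cong; subst₂)
  open import Relation.Nullary using (contradiction)
  open Walks.Metric G conn

  RadioPair : (Fin n → ℕ) → Fin n → Fin n → Set
  RadioPair g u v = diam G + 1 ≤ ∣ g u - g v ∣ + dist G u v

  radioPair-sym : ∀ {g u v} → RadioPair g u v → RadioPair g v u
  radioPair-sym {g} {u} {v} =
    subst₂ (λ a b → diam G + 1 ≤ a + b) (∣-∣-comm (g u) (g v)) (dist-sym u v)

  radio-by-order : ∀ (x : Permutation′ n) {g} →
    (∀ {i j} → toℕ i < toℕ j → RadioPair g (x ⟨$⟩ʳ i) (x ⟨$⟩ʳ j)) → IsRadioLabeling G g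
  radio-by-order x {g} ordered u v u≢v with Fin.<-cmp (x ⟨$⟩ˡ u) (x ⟨$⟩ˡ v)
  ... | tri< p<q _ _ = subst₂ (RadioPair g) (inverseʳ x) (inverseʳ x) (ordered p<q)
  ... | tri≈ _ p≡q _ =
    contradiction (trans (sym (inverseʳ x)) (trans (cong (x ⟨$⟩ʳ_) p≡q) (inverseʳ x))) u≢v
  ... | tri> _ _ q<p = radioPair-sym {g} (subst₂ (RadioPair g) (inverseʳ x) (inverseʳ x) (ordered q<p))

module RadioNumber {m} (G : Graph (ℕ.suc m)) (conn : Connected G) (1≤m : 1 ℕ.≤ m)
                   (L₀ : Subset (ℕ.suc m)) {w₀} (w₀∈L₀ : T (lookup L₀ w₀)) where
  open ℕ using (ℕ; suc; z≤n; s≤s)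
  import Data.Nat.Properties as ℕₚ
  open import Data.Integer using (ℤ; +_; -_; _+_; _-_; _*_; _≤_; +≤+; 0ℤ; ∣_∣)
  open import Data.Integer.Properties
  open import Data.Integer.Tactic.RingSolver using (solve-∀)
  open import Data.Fin using (Fin; toℕ; inject₁; fromℕ; fromℕ<) renaming (zero to fzero; suc to fsuc)
  import Data.Fin.Properties as Fin
  open import Data.Fin.Permutation using (_⟨$⟩ʳ_; _⟨$⟩ˡ_; inverseˡ)
  open import Data.Product using (∃-syntax; _×_; _,_; proj₂)
  open import Function.Bundles using (_⇔_; mk⇔; Equivalence; Injection)
  open import Function.Definitions using (Injective)
  open import Function.Properties.Inverse using (↔⇒↣)
  open import Relation.Binary.PropositionalEquality
    using (_≡_; refl; sym; trans; cong; cong₂; subst; subst₂; module ≡-Reasoning)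
  open import Relation.Nullary using (yes; no; contradiction)
  open Equivalence using (to; from)
  open Folds
  open Diameter
  open Levels
  open Sorting
  open Layers G conn L₀ w₀∈L₀
  open Radio G conn
  open PrefixSums

  d k L δ : ℕ
  d = diam G
  k = diamSet G L₀
  L = totalLevel G L₀
  δ = deltaG L₀

  -- (p − 1)(d − k + 1) + δ − 2L(G), with p − 1 = m.
  bound : ℤ
  bound = + m * + (d ℕ.∸ k ℕ.+ 1) + + δ - + (2 ℕ.* L)

  dist≤via-L₀ℤ : ∀ u v → + dist G u v ≤ + ℓ u + + k + + ℓ v
  dist≤via-L₀ℤ u v = subst (+ dist G u v ≤_) (trans (pos-+ _ (ℓ v)) (cong (_+ + ℓ v) (pos-+ (ℓ u) k)))
                           (+≤+ (dist≤via-L₀ u v))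

  module Along (x : Ordering m) where

    X : Fin (suc m) → Fin (suc m)
    X i = x ⟨$⟩ʳ i

    X-injective : Injective _≡_ _≡_ X
    X-injective = Injection.injective (↔⇒↣ x)

    -- t as a position in the ordering; junk value 0 past the end.
    position : ℕ → Fin (suc m)
    position t with t ℕ.<? suc m
    ... | yes t<1+m = fromℕ< t<1+m
    ... | no _      = fzero

    position-toℕ : ∀ i → position (toℕ i) ≡ i
    position-toℕ i with toℕ i ℕ.<? suc m
    ... | yes i<1+m = Fin.fromℕ<-toℕ i i<1+m
    ... | no i≮1+m  = contradiction (Fin.toℕ<n i) i≮1+m

    toℕ-position : ∀ {t} → t ℕ.≤ m → toℕ (position t) ≡ t
    toℕ-position {t} t≤m with t ℕ.<? suc m
    ... | yes t<1+m = Fin.toℕ-fromℕ< t<1+m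
    ... | no t≮1+m  = contradiction (s≤s t≤m) t≮1+m

    position-< : ∀ {t} → t ℕ.< m → toℕ (position t) ℕ.< toℕ (position (suc t))
    position-< {t} t<m =
      subst₂ ℕ._<_ (sym (toℕ-position (ℕₚ.<⇒≤ t<m))) (sym (toℕ-position t<m)) (ℕₚ.n<1+n t)

    lev : ℕ → ℤ
    lev t = + ℓ (X (position t))

    gap : ℕ → ℤ
    gap t = + d + + 1 - lev t - lev (suc t) - + k

    lev-toℕ : ∀ i → lev (toℕ i) ≡ + ℓ (X i)
    lev-toℕ i = cong (λ p → + ℓ (X p)) (position-toℕ i)

    lev-inject₁ : ∀ (i : Fin m) → lev (toℕ i) ≡ + ℓ (X (inject₁ i))
    lev-inject₁ i = trans (cong lev (sym (Fin.toℕ-inject₁ i))) (lev-toℕ (inject₁ i))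

    φpos≡sum<gap : ∀ i → φpos G L₀ x i ≡ sum< (toℕ i) gap
    φpos≡sum<gap = seqFromInc≡sum< gap λ i →
      cong₂ (λ a b → + d + + 1 - a - b - + k) (sym (lev-inject₁ i)) (sym (lev-toℕ (fsuc i)))

    GapRadio : Set
    GapRadio = ∀ (i j : Fin (suc m)) → toℕ i ℕ.< toℕ j →
               + d + + 1 ≤ (sum< (toℕ j) gap - sum< (toℕ i) gap) + + dist G (X i) (X j)

    condB⇔GapRadio : CondB G L₀ x ⇔ GapRadio
    condB⇔GapRadio = mk⇔ (λ B i j i<j → to (neg-+≤⇔ (window≡ i<j)) (B i j i<j))
                         (λ B i j i<j → from (neg-+≤⇔ (window≡ i<j)) (B i j i<j))
      where
      window≡ : ∀ {i j : Fin (suc m)} → toℕ i ℕ.< toℕ j →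
        sumBetween (toℕ i) (toℕ j) (λ t → + ℓ (X (inject₁ t)) + + ℓ (X (fsuc t)) + + k - + d - + 1)
          ≡ - (sum< (toℕ j) gap - sum< (toℕ i) gap)
      window≡ {i} {j} i<j =
        trans (sumBetween≡sum< (λ t → - gap t) term≡ (ℕₚ.<⇒≤ i<j) (ℕ.s≤s⁻¹ (Fin.toℕ<n j)))
              (trans (cong₂ _-_ (sum<-neg (toℕ j) gap) (sum<-neg (toℕ i) gap))
                     (negate-diff (sum< (toℕ j) gap) (sum< (toℕ i) gap)))
        where
        negate-gap : ∀ a b c e → a + b + c - e - + 1 ≡ - (e + + 1 - a - b - c)
        negate-gap = solve-∀
        term≡ : ∀ (t : Fin m) → + ℓ (X (inject₁ t)) + + ℓ (X (fsuc t)) + + k - + d - + 1 ≡ - gap (toℕ t)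
        term≡ t = trans (cong₂ (λ a b → a + b + + k - + d - + 1) (sym (lev-inject₁ t)) (sym (lev-toℕ (fsuc t))))
                        (negate-gap (lev (toℕ t)) (lev (suc (toℕ t))) (+ k) (+ d))
        negate-diff : ∀ a b → - a - - b ≡ - (a - b)
        negate-diff = solve-∀

    sum-levels : sum< (suc m) lev ≡ + L
    sum-levels = begin
      sum< (suc m) lev                 ≡⟨ sym (sumFℤ≡sum< (suc m) lev) ⟩
      sumFℤ {suc m} (λ i → lev (toℕ i)) ≡⟨ sumFℤ-cong lev-toℕ ⟩
      sumFℤ (λ i → + ℓ (X i))          ≡⟨ sumFℤ-pos (λ i → ℓ (X i)) ⟩
      + sumF (λ i → ℓ (X i))           ≡⟨ cong +_ (sym (sumF-permute ℓ x)) ⟩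
      + sumF ℓ                         ≡⟨ cong +_ (sym (totalLevel≡sumF G L₀)) ⟩
      + L                              ∎
      where open ≡-Reasoning

    -- Each level is counted twice, except those of the two ends.
    sum-gaps : sum< m gap ≡ bound - + δ + (lev 0 + lev m)
    sum-gaps = begin
      sum< m gap
        ≡⟨ sum<-cong m (λ t _ → split-gap (lev t) (lev (suc t))) ⟩
      sum< m (λ t → K - (lev t + lev (suc t)))
        ≡⟨ sum<-distrib-- m (λ _ → K) (λ t → lev t + lev (suc t)) ⟩
      sum< m (λ _ → K) - sum< m (λ t → lev t + lev (suc t))
        ≡⟨ cong₂ _-_ (sum<-const m K) (sum<-distrib-+ m lev (λ t → lev (suc t))) ⟩
      + m * K - (sum< m lev + sum< m (λ t → lev (suc t)))
        ≡⟨ cong (λ s → + m * K - s) (cong₂ _+_ all-but-last all-but-first) ⟩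
      + m * K - ((+ L - lev m) + (+ L - lev 0))
        ≡⟨ regroup (+ m) (+ d) (+ k) (+ δ) (+ L) (lev 0) (lev m) ⟩
      + m * (+ d - + k + + 1) + + δ - (+ L + + L) - + δ + (lev 0 + lev m)
        ≡⟨ cong₂ (λ a b → + m * a + + δ - b - + δ + (lev 0 + lev m)) (sym d∸k+1) (sym two-L) ⟩
      bound - + δ + (lev 0 + lev m) ∎
      where
      open ≡-Reasoning
      K : ℤ
      K = + d + + 1 - + k
      split-gap : ∀ a b → + d + + 1 - a - b - + k ≡ K - (a + b)
      split-gap a b = shuffle (+ d) (+ k) a b
        where shuffle : ∀ D c a b → D + + 1 - a - b - c ≡ D + + 1 - c - (a + b)
              shuffle = solve-∀
      all-but-last : sum< m lev ≡ + L - lev m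
      all-but-last = trans (cancel (sum< m lev) (lev m)) (cong (_- lev m) sum-levels)
        where cancel : ∀ s a → s ≡ s + a - a
              cancel = solve-∀
      all-but-first : sum< m (λ t → lev (suc t)) ≡ + L - lev 0
      all-but-first = trans (cancel (sum< m (λ t → lev (suc t))) (lev 0))
                            (cong (_- lev 0) (trans (sym (sum<-shift m lev)) sum-levels))
        where cancel : ∀ s a → s ≡ a + s - a
              cancel = solve-∀
      d∸k+1 : + (d ℕ.∸ k ℕ.+ 1) ≡ + d - + k + + 1
      d∸k+1 = trans (pos-+ (d ℕ.∸ k) 1)
                    (cong (_+ + 1) (trans (sym (⊖-≥ (diamSet≤diam G L₀))) (sym (m-n≡m⊖n d k))))
      two-L : + (2 ℕ.* L) ≡ + L + + L
      two-L = trans (cong (λ l → + (L ℕ.+ l)) (ℕₚ.+-identityʳ L)) (pos-+ L L)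
      regroup : ∀ M D c δ l a z →
                M * (D + + 1 - c) - ((l - z) + (l - a)) ≡ M * (D - c + + 1) + δ - (l + l) - δ + (a + z)
      regroup = solve-∀

    ends : ℕ
    ends = ℓ (X fzero) ℕ.+ ℓ (X (fromℕ m))

    lev-ends : lev 0 + lev m ≡ + ends
    lev-ends =
      trans (cong₂ _+_ (lev-toℕ fzero) (trans (cong lev (sym (Fin.toℕ-fromℕ m))) (lev-toℕ (fromℕ m))))
            (sym (pos-+ (ℓ (X fzero)) (ℓ (X (fromℕ m)))))

    condA⇔ends≡δ : CondA G L₀ x ⇔ ends ≡ δ
    condA⇔ends≡δ = deltaG-cases⇔ ends

    δ≤ends : δ ℕ.≤ ends
    δ≤ends = deltaG≤ℓ+ℓ λ X0≡Xm → ℕₚ.<⇒≢ 1≤m (trans (cong toℕ (X-injective X0≡Xm)) (Fin.toℕ-fromℕ m))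

    bound≤sum-gaps : bound ≤ sum< m gap
    bound≤sum-gaps =
      ≤-rearrange (trans (shuffle bound (+ δ) (lev 0 + lev m)) (cong (_- bound) (sym sum-gaps)))
                  (subst (+ δ ≤_) (sym lev-ends) (+≤+ δ≤ends))
      where shuffle : ∀ b δ e → e - δ ≡ b - δ + e - b
            shuffle = solve-∀

    module Labelled (f : Fin (suc m) → ℕ) (f-radio : IsRadioLabeling G f)
                    (f-increasing : ∀ {i j} → toℕ i ℕ.< toℕ j → f (X i) ℕ.< f (X j)) where

      label : ℕ → ℤ
      label t = + f (X (position t))

      step : ℕ → ℤ
      step t = label (suc t) - label t

      radio-along : ∀ {i j} → toℕ i ℕ.< toℕ j →
                    + d + + 1 ≤ (+ f (X j) - + f (X i)) + + dist G (X i) (X j)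
      radio-along {i} {j} i<j =
        subst (λ s → + d + + 1 ≤ s + + dist G (X i) (X j)) (+∣m-n∣≡n-m (ℕₚ.<⇒≤ (f-increasing i<j)))
              (to (+-≤-+⇔ d 1 ℕ.∣ f (X i) - f (X j) ∣ (dist G (X i) (X j)))
                  (f-radio (X i) (X j) λ Xi≡Xj → ℕₚ.<⇒≢ i<j (cong toℕ (X-injective Xi≡Xj))))

      gap≤step : ∀ t → t ℕ.< m → gap t ≤ step t
      gap≤step t t<m = ≤-rearrange (shuffle (step t) (lev t) (lev (suc t)) (+ k) (+ d))
        (≤-trans (radio-along (position-< t<m))
                 (+-monoʳ-≤ (step t) (dist≤via-L₀ℤ (X (position t)) (X (position (suc t))))))
        where
        shuffle : ∀ s a b c D → s + (a + c + b) - (D + + 1) ≡ s - (D + + 1 - a - b - c)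
        shuffle = solve-∀

      sum-steps≤span : sum< m step ≤ + span f
      sum-steps≤span = subst (_≤ + span f) (sym (sum<-telescope m label))
        (≤-trans (n-m≤+∣m-n∣ (f (X (position 0))) (f (X (position m))))
                 (+≤+ (∣-∣≤span f (X (position 0)) (X (position m)))))

      bound≤span : bound ≤ + span f
      bound≤span = ≤-trans bound≤sum-gaps (≤-trans (sum<-mono-≤ m gap≤step) sum-steps≤span)

      module Tight (span≤bound : + span f ≤ bound) where

        sum-steps≤sum-gaps : sum< m step ≤ sum< m gap
        sum-steps≤sum-gaps = ≤-trans sum-steps≤span (≤-trans span≤bound bound≤sum-gaps)

        sum-gaps≤bound : sum< m gap ≤ bound
        sum-gaps≤bound = ≤-trans (sum<-mono-≤ m gap≤step) (≤-trans sum-steps≤span span≤bound)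

        ends≡δ : ends ≡ δ
        ends≡δ = ℕₚ.≤-antisym (drop‿+≤+ ends≤δ) δ≤ends
          where
          ends≤δ : + ends ≤ + δ
          ends≤δ = subst (_≤ + δ) lev-ends
            (≤-rearrange (shuffle bound (+ δ) (lev 0 + lev m)) (subst (_≤ bound) sum-gaps sum-gaps≤bound))
            where shuffle : ∀ b δ e → b - (b - δ + e) ≡ δ - e
                  shuffle = solve-∀

        gapRadio : GapRadio
        gapRadio i j i<j = ≤-trans (radio-along i<j) (+-monoˡ-≤ (+ dist G (X i) (X j)) steps≤gaps)
          where
          label-toℕ : ∀ i → sum< (toℕ i) step ≡ + f (X i) - label 0
          label-toℕ i =
            trans (sum<-telescope (toℕ i) label) (cong (λ p → + f (X p) - label 0) (position-toℕ i))
          steps≤gaps : + f (X j) - + f (X i) ≤ sum< (toℕ j) gap - sum< (toℕ i) gap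
          steps≤gaps = subst (_≤ _)
            (trans (cong₂ _-_ (label-toℕ j) (label-toℕ i)) (cancel (+ f (X j)) (+ f (X i)) (label 0)))
            (sum<-tight gap≤step sum-steps≤sum-gaps (ℕₚ.<⇒≤ i<j) (ℕ.s≤s⁻¹ (Fin.toℕ<n j)))
            where cancel : ∀ a b c → (a - c) - (b - c) ≡ a - b
                  cancel = solve-∀

    module Satisfying (gapRadio : GapRadio) where

      gap≥0 : ∀ t → t ℕ.< m → 0ℤ ≤ gap t
      gap≥0 t t<m = ≤-trans (+≤+ z≤n) (≤-rearrange (shuffle (gap t) (+ d))
        (≤-trans (subst (λ s → + d + + 1 ≤ s + + dist G (X p) (X q)) one-step (gapRadio p q (position-< t<m)))
                 (+-monoʳ-≤ (gap t) (+≤+ (dist≤diam G (X p) (X q))))))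
        where
        p q : Fin (suc m)
        p = position t
        q = position (suc t)
        one-step : sum< (toℕ (position (suc t))) gap - sum< (toℕ (position t)) gap ≡ gap t
        one-step rewrite toℕ-position t<m | toℕ-position (ℕₚ.<⇒≤ t<m) = cancel (sum< t gap) (gap t)
          where cancel : ∀ s g → s + g - s ≡ g
                cancel = solve-∀
        shuffle : ∀ g D → g + D - (D + + 1) ≡ g - + 1
        shuffle = solve-∀

      φ≡sum<gap : ∀ v → φ G L₀ x v ≡ sum< (toℕ (x ⟨$⟩ˡ v)) gap
      φ≡sum<gap v = φpos≡sum<gap (x ⟨$⟩ˡ v)

      φ≥0 : ∀ v → 0ℤ ≤ φ G L₀ x v
      φ≥0 v = subst (0ℤ ≤_) (sym (φ≡sum<gap v))
                    (sum<-mono-bound gap≥0 z≤n (ℕ.s≤s⁻¹ (Fin.toℕ<n (x ⟨$⟩ˡ v))))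

      φ≤sum-gaps : ∀ v → φ G L₀ x v ≤ sum< m gap
      φ≤sum-gaps v = subst (_≤ sum< m gap) (sym (φ≡sum<gap v))
                           (sum<-mono-bound gap≥0 (ℕ.s≤s⁻¹ (Fin.toℕ<n (x ⟨$⟩ˡ v))) ℕₚ.≤-refl)

      ∣φ∣ : Fin (suc m) → ℕ
      ∣φ∣ v = ∣ φ G L₀ x v ∣

      ∣φ∣-along : ∀ i → + ∣φ∣ (X i) ≡ sum< (toℕ i) gap
      ∣φ∣-along i = trans (0≤i⇒+∣i∣≡i (φ≥0 (X i)))
                          (trans (φ≡sum<gap (X i)) (cong (λ p → sum< (toℕ p) gap) (inverseˡ x)))

      ∣φ∣-radio : IsRadioLabeling G ∣φ∣
      ∣φ∣-radio = radio-by-order x {∣φ∣} λ {i} {j} i<j →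
        from (+-≤-+⇔ d 1 ℕ.∣ ∣φ∣ (X i) - ∣φ∣ (X j) ∣ (dist G (X i) (X j)))
             (≤-trans (gapRadio i j i<j) (+-monoˡ-≤ (+ dist G (X i) (X j))
               (subst (_≤ + ℕ.∣ ∣φ∣ (X i) - ∣φ∣ (X j) ∣) (cong₂ _-_ (∣φ∣-along j) (∣φ∣-along i))
                      (n-m≤+∣m-n∣ (∣φ∣ (X i)) (∣φ∣ (X j))))))

      ∣φ∣-span≤bound : CondA G L₀ x → + span ∣φ∣ ≤ bound
      ∣φ∣-span≤bound condA = begin
        + span ∣φ∣                    ≤⟨ +≤+ (span-least ∣φ∣ ∣φ∣≤∣total∣) ⟩
        + ∣ sum< m gap ∣              ≡⟨ 0≤i⇒+∣i∣≡i total≥0 ⟩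
        sum< m gap                    ≡⟨ sum-gaps ⟩
        bound - + δ + (lev 0 + lev m) ≡⟨ cong (λ e → bound - + δ + e) (trans lev-ends (cong +_ (to condA⇔ends≡δ condA))) ⟩
        bound - + δ + + δ             ≡⟨ cancel bound (+ δ) ⟩
        bound                         ∎
        where
        open ≤-Reasoning
        total≥0 : 0ℤ ≤ sum< m gap
        total≥0 = sum<-mono-bound gap≥0 z≤n ℕₚ.≤-refl
        ∣φ∣≤∣total∣ : ∀ v → ∣φ∣ v ℕ.≤ ∣ sum< m gap ∣
        ∣φ∣≤∣total∣ v = drop‿+≤+ (subst₂ _≤_ (sym (0≤i⇒+∣i∣≡i (φ≥0 v))) (sym (0≤i⇒+∣i∣≡i total≥0))
                                          (φ≤sum-gaps v))
        cancel : ∀ b δ → b - δ + δ ≡ b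
        cancel = solve-∀

  module _ (f : Fin (suc m) → ℕ) (f-radio : IsRadioLabeling G f) where
    private
      f-injective : Injective _≡_ _≡_ f
      f-injective = radio-injective G f-radio
      x : Ordering m
      x = sortBy f f-injective
      module Sorted = Along x
      module Ordered = Sorted.Labelled f f-radio (sortBy-increasing f f-injective)

    bound≤span : bound ≤ + span f
    bound≤span = Ordered.bound≤span

    span≤bound⇒conditions : + span f ≤ bound → ∃[ x ] (CondA G L₀ x × CondB G L₀ x)
    span≤bound⇒conditions span≤bound =
      x , from Sorted.condA⇔ends≡δ Tight.ends≡δ , from Sorted.condB⇔GapRadio Tight.gapRadio
      where module Tight = Ordered.Tight span≤bound

  module _ (x : Ordering m) (condA : CondA G L₀ x) (condB : CondB G L₀ x) where
    open Along x
    open Satisfying (to condB⇔GapRadio condB)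

    φ-optimal : (∀ v → 0ℤ ≤ φ G L₀ x v) × IsOptimalRadioLabeling G ∣φ∣
    φ-optimal = φ≥0 , ∣φ∣-radio ,
                λ g g-radio → drop‿+≤+ (≤-trans (∣φ∣-span≤bound condA) (bound≤span g g-radio))

    φ-span-is-bound : RadioNumberIs G bound
    φ-span-is-bound = span ∣φ∣ , ((∣φ∣ , ∣φ∣-radio , refl) , proj₂ (proj₂ φ-optimal)) ,
                      ≤-antisym (∣φ∣-span≤bound condA) (bound≤span ∣φ∣ ∣φ∣-radio)

open import Data.Nat using (ℕ; suc; _+_; _*_; _∸_; _≤_)
open import Data.Nat.Properties using (≤-trans; n≤1+n)
open import Data.Integer using (+_; _-_; ∣_∣) renaming (_*_ to _*ℤ_; _+_ to _+ℤ_; _≤_ to _≤ℤ_)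
open import Data.Integer.Properties using (≤-reflexive)
open import Data.Fin using (Fin; inject₁) renaming (suc to fsuc)
open import Data.Fin.Permutation using (_⟨$⟩ʳ_)
open import Data.Product using (_×_; ∃-syntax; _,_)
open import Function.Bundles using (_⇔_; mk⇔)
open import Relation.Binary.PropositionalEquality using (_≡_; trans; cong)

theorem3p1 : (m : ℕ) (G : Graph (suc m)) → Connected G → 2 ≤ diam G →
    (L₀ : Subset (suc m)) → InducedConnected G L₀ →
    (∃[ y ] (∀ (i : Fin m) →
        dist G (y ⟨$⟩ʳ inject₁ i) (y ⟨$⟩ʳ fsuc i)
          ≡ distSet G L₀ (y ⟨$⟩ʳ inject₁ i) + distSet G L₀ (y ⟨$⟩ʳ fsuc i) + diamSet G L₀)) →
    (RadioNumberIs G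
        (+ m *ℤ + (diam G ∸ diamSet G L₀ + 1) +ℤ + deltaG L₀ - + (2 * totalLevel G L₀))
      ⇔ (∃[ x ] (CondA G L₀ x × CondB G L₀ x)))
    × (∀ x → CondA G L₀ x → CondB G L₀ x →
        (∀ v → + 0 ≤ℤ φ G L₀ x v)
        × IsOptimalRadioLabeling G (λ v → ∣ φ G L₀ x v ∣))
theorem3p1 m G conn 2≤diam L₀ ((w₀ , w₀∈L₀) , _) _ =
  mk⇔ (λ (r , ((f , f-radio , span≡r) , _) , r≡bound) →
         span≤bound⇒conditions f f-radio (≤-reflexive (trans (cong +_ span≡r) r≡bound)))
      (λ (x , condA , condB) → φ-span-is-bound x condA condB) ,
  φ-optimal
  where open RadioNumber G conn (Diameter.1≤diam⇒1≤m G (≤-trans (n≤1+n 1) 2≤diam)) L₀ w₀∈L₀
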